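{- Let $m$ be a positive integer such that at least two distinct primes appear to odd exponent in the prime factorization of $m$. Then $\nu_2(m) \equiv 0 \pmod 2$.
   Context: $\nu_2(m)$ denotes the number of partitions of $m$ in which exactly two distinct part sizes appear. -}

module Defs where

open import Data.Nat using (ℕ; zero; suc; _+_; _∸_; _≤?_; _≟_)
open import Data.List using (List; []; _∷_; _++_; map; length; filter; deduplicate)
open import Relation.Nullary using (yes; no)

-- partsUpTo fuel n k : all partitions of n into parts of size ≤ k, each listed
-- as a non-increasing list of positive integers (fuel ≥ n suffices).
partsUpTo : ℕ → ℕ → ℕ → List (List ℕ)
partsUpTo _ zero zero = [] ∷ []
partsUpTo _ (suc _) zero = []
partsUpTo zero n (suc k) = []
partsUpTo (suc f) n (suc k) with suc k ≤? n
... | yes _ = partsUpTo (suc f) n k ++ map (suc k ∷_) (partsUpTo f (n ∸ suc k) (suc k))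
... | no _  = partsUpTo (suc f) n k

partitions : ℕ → List (List ℕ)
partitions n = partsUpTo (suc n) n n

distinctParts : List ℕ → ℕ
distinctParts p = length (deduplicate _≟_ p)

ν₂ : ℕ → ℕ
ν₂ m = length (filter (λ p → distinctParts p ≟ 2) (partitions m))

open import Data.Nat using (_^_; _%_)
open import Data.Nat.Divisibility using (_∣_)
open import Data.Product using (_×_)
open import Relation.Nullary using (¬_)

ExactExponent : ℕ → ℕ → ℕ → Set
ExactExponent p e m = (p ^ e ∣ m) × ¬ (p ^ suc e ∣ m)

module Submission where

-- A partition with two part sizes is aⁱ bʲ (a > b). Conjugation sends it to (i + j)ᵇ iᵃ⁻ᵇ,
-- again a partition of m with two part sizes, and is an involution. An involution of a finite
-- list has as many members as fixed points modulo 2 (InvolutionParity), so ν₂ m is congruent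
-- to the number of self-conjugate ones. These are (x + z)ˣ xᶻ, in bijection with the factor
-- pairs m = u · v, u < v, u ≡ v (mod 2), via (u , v) = (x , x + 2z). One of p, q, say r, is
-- odd; exchanging the r-parts of u and v and reordering is an involution of the factor pairs
-- (ValuationSwap) without fixed points: a fixed point would make the exponent of r even, or
-- m = rᵉ · w², making the exponent of the other prime even. So that number is even too.

open import Defs
open import Data.Nat using (ℕ; zero; suc; _+_; _*_; _∸_; _^_; _≤_; _<_; z≤n; s≤s; _≤?_; _≟_; _%_; _/_; NonZero; >-nonZero; nonTrivial⇒≢1; nonTrivial⇒n>1)
open import Data.Nat.Properties
open import Data.Nat.DivMod
open import Data.Nat.Divisibility
open import Data.Nat.Primality
open import Data.Nat.ListAction using (sum)
open import Data.Nat.ListAction.Properties using (sum-++)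
open import Data.Nat.Tactic.RingSolver using (solve-∀)
open import Data.List using (List; []; _∷_; _++_; length; filter; map; replicate; deduplicate)
open import Data.List.Properties
  using (filter-reject; filter-all; filter-idem; filter-none; ++-identityʳ; ∷-injectiveʳ; length-replicate; ≡-dec)
open import Data.List.Membership.Propositional using (_∈_)
open import Data.List.Membership.Propositional.Properties
  using (∈-filter⁺; ∈-filter⁻; ∈-map⁺; ∈-map⁻; ∈-++⁺ˡ; ∈-++⁺ʳ; ∈-++⁻; ∈-deduplicate⁻)
open import Data.List.Relation.Unary.Any using (here; there)
open import Data.List.Relation.Unary.All as All using (All; []; _∷_)
open import Data.List.Relation.Unary.All.Properties using (All¬⇒¬Any; replicate⁺)
open import Data.List.Relation.Unary.AllPairs using ([]; _∷_)
open import Data.List.Relation.Unary.Unique.Propositional using (Unique)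
import Data.List.Relation.Unary.Unique.Propositional.Properties as Unique
open import Data.List.Relation.Binary.Disjoint.Propositional using (Disjoint)
open import Data.Product using (∃-syntax; _×_; _,_; proj₁; proj₂; map₁)
open import Data.Sum using (_⊎_; inj₁; inj₂)
open import Data.Empty using (⊥-elim)
open import Function using (_∘_)
open import Relation.Nullary using (¬_; Dec; yes; no; ¬?)
open import Relation.Binary.Definitions using (DecidableEquality; tri<; tri≈; tri>)
open import Relation.Binary.PropositionalEquality

-- An involution ι of a duplicate-free list xs pairs off its non-fixed points, so
-- length xs and the number of fixed points agree modulo 2.
module InvolutionParity {A : Set} (_≟ᴬ_ : DecidableEquality A) (ι : A → A) where

  fixed? : (x : A) → Dec (ι x ≡ x)
  fixed? x = ι x ≟ᴬ x

  differs? : (z y : A) → Dec (¬ y ≡ z)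
  differs? z y = ¬? (y ≟ᴬ z)

  remove : A → List A → List A
  remove z = filter (differs? z)

  length-remove : ∀ {z} ys → Unique ys → z ∈ ys → length ys ≡ suc (length (remove z ys))
  length-remove {z} (y ∷ ys) (y∉ys ∷ _) (here refl) =
    cong (suc ∘ length) (sym (trans (filter-reject (differs? y) (λ y≢y → y≢y refl))
                                    (filter-all (differs? y) (All.map ≢-sym y∉ys))))
  length-remove {z} (y ∷ ys) (y∉ys ∷ u) (there z∈ys) with y ≟ᴬ z
  ... | yes refl = ⊥-elim (All¬⇒¬Any y∉ys z∈ys)
  ... | no _     = cong suc (length-remove ys u z∈ys)

  fixed-remove : ∀ {z} ys → ι z ≢ z → filter fixed? (remove z ys) ≡ filter fixed? ys
  fixed-remove [] _ = refl
  fixed-remove {z} (y ∷ ys) z-moved with y ≟ᴬ z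
  ... | yes refl = trans (fixed-remove ys z-moved) (sym (filter-reject fixed? z-moved))
  ... | no _ with fixed? y
  ...   | yes _ = cong (y ∷_) (fixed-remove ys z-moved)
  ...   | no _  = fixed-remove ys z-moved

  record InvolutionOn (xs : List A) : Set where
    field
      closed     : ∀ {x} → x ∈ xs → ι x ∈ xs
      involutive : ∀ {x} → x ∈ xs → ι (ι x) ≡ x
  open InvolutionOn

  drop-fixed : ∀ {x rest} → Unique (x ∷ rest) → InvolutionOn (x ∷ rest) → ι x ≡ x → InvolutionOn rest
  closed (drop-fixed {x} {rest} (x∉rest ∷ _) inv ιx≡x) {y} y∈rest with closed inv (there y∈rest)
  ... | there ιy∈rest = ιy∈rest
  ... | here ιy≡x = ⊥-elim (All¬⇒¬Any x∉rest (subst (_∈ rest) y≡x y∈rest))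
    where
    y≡x : y ≡ x
    y≡x = trans (sym (involutive inv (there y∈rest))) (trans (cong ι ιy≡x) ιx≡x)
  involutive (drop-fixed _ inv _) y∈rest = involutive inv (there y∈rest)

  drop-pair : ∀ {x rest} → Unique (x ∷ rest) → InvolutionOn (x ∷ rest) → ι x ≢ x →
              ι x ∈ rest × InvolutionOn (remove (ι x) rest)
  drop-pair {x} {rest} (x∉rest ∷ _) inv ιx≢x = ιx∈rest , record { closed = closed′ ; involutive = involutive′ }
    where
    ιx∈rest : ι x ∈ rest
    ιx∈rest with closed inv (here refl)
    ... | here ιx≡x = ⊥-elim (ιx≢x ιx≡x)
    ... | there w = w
    closed′ : ∀ {y} → y ∈ remove (ι x) rest → ι y ∈ remove (ι x) rest
    closed′ {y} w with ∈-filter⁻ (differs? (ι x)) {xs = rest} w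
    ... | y∈rest , y≢ιx with closed inv (there y∈rest)
    ...   | here ιy≡x = ⊥-elim (y≢ιx (trans (sym (involutive inv (there y∈rest))) (cong ι ιy≡x)))
    ...   | there ιy∈rest = ∈-filter⁺ (differs? (ι x)) ιy∈rest ιy≢ιx
      where
      ιy≢ιx : ι y ≢ ι x
      ιy≢ιx ιy≡ιx = All¬⇒¬Any x∉rest (subst (_∈ rest) y≡x y∈rest)
        where
        y≡x : y ≡ x
        y≡x = trans (sym (involutive inv (there y∈rest))) (trans (cong ι ιy≡ιx) (involutive inv (here refl)))
    involutive′ : ∀ {y} → y ∈ remove (ι x) rest → ι (ι y) ≡ y
    involutive′ w = involutive inv (there (proj₁ (∈-filter⁻ (differs? (ι x)) {xs = rest} w)))

  -- The non-fixed points come in pairs; the bound n on the length drives the recursion.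
  pairing : ∀ n xs → length xs ≤ n → Unique xs → InvolutionOn xs →
            ∃[ k ] length xs ≡ length (filter fixed? xs) + 2 * k
  pairing _ [] _ _ _ = 0 , refl
  pairing (suc n) (x ∷ rest) (s≤s len≤n) u@(_ ∷ u-rest) inv with fixed? x
  ... | yes ιx≡x =
    let k , eq = pairing n rest len≤n u-rest (drop-fixed u inv ιx≡x) in k , cong suc eq
  ... | no ιx≢x with drop-pair u inv ιx≢x
  ...   | ιx∈rest , inv′ with pairing n (remove (ι x) rest) bound (Unique.filter⁺ (differs? (ι x)) u-rest) inv′
    where
    len-rest : length rest ≡ suc (length (remove (ι x) rest))
    len-rest = length-remove rest u-rest ιx∈rest
    bound : length (remove (ι x) rest) ≤ n
    bound = ≤-trans (n≤1+n _) (subst (_≤ n) len-rest len≤n)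
  ...     | k , eq = suc k , (begin
      suc (length rest)                                    ≡⟨ cong suc (length-remove rest u-rest ιx∈rest) ⟩
      2 + length (remove (ι x) rest)                       ≡⟨ cong (2 +_) eq ⟩
      2 + (length (filter fixed? (remove (ι x) rest)) + 2 * k)
        ≡⟨ cong (λ l → 2 + (length l + 2 * k)) (fixed-remove rest ιιx≢ιx) ⟩
      2 + (length (filter fixed? rest) + 2 * k)            ≡⟨ shift (length (filter fixed? rest)) k ⟩
      length (filter fixed? rest) + 2 * suc k              ∎)
    where
    open ≡-Reasoning
    ιιx≢ιx : ι (ι x) ≢ ι x
    ιιx≢ιx e = ιx≢x (trans (sym e) (involutive inv (here refl)))
    shift : ∀ a k → 2 + (a + 2 * k) ≡ a + 2 * suc k
    shift = solve-∀

  involution-parity : ∀ xs → Unique xs → InvolutionOn xs → length xs % 2 ≡ length (filter fixed? xs) % 2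
  involution-parity xs u inv =
    let k , eq = pairing (length xs) xs ≤-refl u inv
    in trans (cong (_% 2) (trans eq (cong (length (filter fixed? xs) +_) (*-comm 2 k))))
             ([m+kn]%n≡m%n (length (filter fixed? xs)) k 2)

data Descending : ℕ → List ℕ → Set where
  []   : ∀ {k} → Descending k []
  cons : ∀ {k x xs} → 1 ≤ x → x ≤ k → Descending x xs → Descending k (x ∷ xs)

descending-weaken : ∀ {k k′ p} → k ≤ k′ → Descending k p → Descending k′ p
descending-weaken _ [] = []
descending-weaken k≤k′ (cons 1≤x x≤k d) = cons 1≤x (≤-trans x≤k k≤k′) d

partsUpTo-≤ : ∀ f n k → suc k ≤ n →
  partsUpTo (suc f) n (suc k) ≡ partsUpTo (suc f) n k ++ map (suc k ∷_) (partsUpTo f (n ∸ suc k) (suc k))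
partsUpTo-≤ f (suc n) k k<n with suc k ≤? suc n
... | yes _ = refl
... | no k≮n = ⊥-elim (k≮n k<n)

partsUpTo-≰ : ∀ f n k → ¬ (suc k ≤ n) → partsUpTo (suc f) n (suc k) ≡ partsUpTo (suc f) n k
partsUpTo-≰ f zero k _ = refl
partsUpTo-≰ f (suc n) k k≮n with suc k ≤? suc n
... | yes k<n = ⊥-elim (k≮n k<n)
... | no _ = refl

partsUpTo-sound : ∀ f n k p → p ∈ partsUpTo f n k → Descending k p × sum p ≡ n
partsUpTo-sound f zero zero .[] (here refl) = [] , refl
partsUpTo-sound (suc f) n (suc k) p p∈ with suc k ≤? n
... | no k≮n = smaller (subst (p ∈_) (partsUpTo-≰ f n k k≮n) p∈)
  where
  smaller : p ∈ partsUpTo (suc f) n k → Descending (suc k) p × sum p ≡ n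
  smaller w = let d , s = partsUpTo-sound (suc f) n k p w in descending-weaken (n≤1+n k) d , s
... | yes k<n with ∈-++⁻ (partsUpTo (suc f) n k) (subst (p ∈_) (partsUpTo-≤ f n k k<n) p∈)
...   | inj₁ w = let d , s = partsUpTo-sound (suc f) n k p w in descending-weaken (n≤1+n k) d , s
...   | inj₂ w with ∈-map⁻ (suc k ∷_) w
...     | q , q∈ , refl = let d , s = partsUpTo-sound f (n ∸ suc k) (suc k) q q∈
                          in cons (s≤s z≤n) ≤-refl d , trans (cong (suc k +_) s) (m+[n∸m]≡n k<n)

partsUpTo-complete : ∀ f n k p → Descending k p → sum p ≡ n → n < f → p ∈ partsUpTo f n k
partsUpTo-complete f .0 zero [] [] refl _ = here refl
partsUpTo-complete f n zero (x ∷ p) (cons 1≤x x≤0 _) _ _ = ⊥-elim (<⇒≱ 1≤x x≤0)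
partsUpTo-complete (suc f) n (suc k) p d s n<f with suc k ≤? n
... | no k≮n = subst (p ∈_) (sym (partsUpTo-≰ f n k k≮n)) (partsUpTo-complete (suc f) n k p (lower p d s) s n<f)
  where
  -- no part can equal suc k, since it would exceed the total n
  lower : ∀ p → Descending (suc k) p → sum p ≡ n → Descending k p
  lower [] [] _ = []
  lower (x ∷ p) (cons 1≤x x≤k d) s = cons 1≤x (≤-pred (≤∧≢⇒< x≤k x≢k)) d
    where
    x≢k : x ≢ suc k
    x≢k refl = k≮n (subst (suc k ≤_) s (m≤m+n (suc k) (sum p)))
... | yes k<n = subst (p ∈_) (sym (partsUpTo-≤ f n k k<n)) (split p d s)
  where
  split : ∀ p → Descending (suc k) p → sum p ≡ n →
          p ∈ partsUpTo (suc f) n k ++ map (suc k ∷_) (partsUpTo f (n ∸ suc k) (suc k))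
  split [] [] s = ∈-++⁺ˡ (partsUpTo-complete (suc f) n k [] [] s n<f)
  split (x ∷ p) (cons 1≤x x≤k d) s with x ≟ suc k
  ... | no x≢k = ∈-++⁺ˡ (partsUpTo-complete (suc f) n k (x ∷ p) (cons 1≤x (≤-pred (≤∧≢⇒< x≤k x≢k)) d) s n<f)
  ... | yes refl = ∈-++⁺ʳ (partsUpTo (suc f) n k) (∈-map⁺ (suc k ∷_)
                     (partsUpTo-complete f (n ∸ suc k) (suc k) p d sum-tail (≤-trans (∸-monoʳ-< (s≤s z≤n) k<n) (≤-pred n<f))))
    where
    sum-tail : sum p ≡ n ∸ suc k
    sum-tail = trans (sym (m+n∸m≡n (suc k) (sum p))) (cong (_∸ suc k) s)

-- No partition is listed twice: the two halves of each unfolding are disjoint by their largest part.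
partsUpTo-unique : ∀ f n k → Unique (partsUpTo f n k)
partsUpTo-unique f zero zero = [] ∷ []
partsUpTo-unique f (suc n) zero = []
partsUpTo-unique zero zero (suc k) = []
partsUpTo-unique zero (suc n) (suc k) = []
partsUpTo-unique (suc f) n (suc k) with suc k ≤? n
... | no k≮n = subst Unique (sym (partsUpTo-≰ f n k k≮n)) (partsUpTo-unique (suc f) n k)
... | yes k<n = subst Unique (sym (partsUpTo-≤ f n k k<n))
        (Unique.++⁺ (partsUpTo-unique (suc f) n k) (Unique.map⁺ ∷-injectiveʳ (partsUpTo-unique f (n ∸ suc k) (suc k))) disjoint)
  where
  disjoint : Disjoint (partsUpTo (suc f) n k) (map (suc k ∷_) (partsUpTo f (n ∸ suc k) (suc k)))
  disjoint (w₁ , w₂) with ∈-map⁻ (suc k ∷_) w₂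
  ... | _ , _ , refl with proj₁ (partsUpTo-sound (suc f) n k _ w₁)
  ...   | cons _ k+1≤k _ = ⊥-elim (1+n≰n k+1≤k)

∈-partitions⁻ : ∀ {m p} → p ∈ partitions m → Descending m p × sum p ≡ m
∈-partitions⁻ {m} = partsUpTo-sound (suc m) m m _

∈-partitions⁺ : ∀ {m p} → Descending m p → sum p ≡ m → p ∈ partitions m
∈-partitions⁺ {m} d s = partsUpTo-complete (suc m) m m _ d s ≤-refl

dedup : List ℕ → List ℕ
dedup = deduplicate _≟_

dedup-repeat : ∀ x xs → dedup (x ∷ x ∷ xs) ≡ dedup (x ∷ xs)
dedup-repeat x xs = cong (x ∷_) (trans (filter-reject (¬? ∘ (x ≟_)) (λ x≢x → x≢x refl))
                                       (filter-idem (¬? ∘ (x ≟_)) (dedup xs)))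

dedup-larger : ∀ x xs → All (_< x) xs → dedup (x ∷ xs) ≡ x ∷ dedup xs
dedup-larger x xs all< = cong (x ∷_) (filter-all (¬? ∘ (x ≟_))
  (All.tabulate λ y∈ x≡y → <-irrefl (sym x≡y) (All.lookup all< (∈-deduplicate⁻ _≟_ xs y∈))))

dedup-block : ∀ i a rest → All (_< a) rest → dedup (replicate (suc i) a ++ rest) ≡ a ∷ dedup rest
dedup-block zero a rest all< = dedup-larger a rest all<
dedup-block (suc i) a rest all< = trans (dedup-repeat a (replicate i a ++ rest)) (dedup-block i a rest all<)

no-sizes : ∀ p → length (dedup p) ≡ 0 → p ≡ []
no-sizes [] _ = refl

descending-bounded : ∀ {k q} → Descending k q → All (_≤ k) q
descending-bounded [] = []
descending-bounded (cons _ x≤k d) = x≤k ∷ All.map (λ y≤x → ≤-trans y≤x x≤k) (descending-bounded d)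

leading-run : ∀ x q → Descending x q →
  ∃[ i ] ∃[ rest ] (x ∷ q ≡ replicate (suc i) x ++ rest) × All (_< x) rest × Descending x rest
leading-run x [] [] = 0 , [] , refl , [] , []
leading-run x (y ∷ q) (cons 1≤y y≤x d) with y ≟ x
... | yes refl = let i , rest , eq , all< , d′ = leading-run y q d in suc i , rest , cong (y ∷_) eq , all< , d′
... | no y≢x = 0 , y ∷ q , refl , y<x ∷ All.map (λ z≤y → ≤-<-trans z≤y y<x) (descending-bounded d) , cons 1≤y y≤x d
  where
  y<x : y < x
  y<x = ≤∧≢⇒< y≤x y≢x

one-size : ∀ {k x} p → Descending k p → All (_< x) p → length (dedup p) ≡ 1 →
  ∃[ j ] ∃[ b ] (p ≡ replicate (suc j) b) × b < x × 1 ≤ b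
one-size (b ∷ q) (cons 1≤b _ d) (b<x ∷ _) one with leading-run b q d
... | j , rest , eq , all< , _ = j , b , trans eq (trans (cong (replicate (suc j) b ++_) rest≡[]) (++-identityʳ _)) , b<x , 1≤b
  where
  rest≡[] : rest ≡ []
  rest≡[] = no-sizes rest (suc-injective (trans (sym (cong length (trans (cong dedup eq) (dedup-block j b rest all<)))) one))

two-sizes⇒blocks : ∀ {k} p → Descending k p → length (dedup p) ≡ 2 →
  ∃[ a ] ∃[ i ] ∃[ b ] ∃[ j ] (p ≡ replicate (suc i) a ++ replicate (suc j) b) × b < a × 1 ≤ b
two-sizes⇒blocks (x ∷ q) (cons _ _ d) two with leading-run x q d
... | i , rest , eq , all< , d′ with one-size rest d′ all< one
  where
  one : length (dedup rest) ≡ 1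
  one = suc-injective (trans (sym (cong length (trans (cong dedup eq) (dedup-block i x rest all<)))) two)
...   | j , b , refl , b<x , 1≤b = x , i , b , j , eq , b<x , 1≤b

blocks⇒two-sizes : ∀ a i b j → b < a → length (dedup (replicate (suc i) a ++ replicate (suc j) b)) ≡ 2
blocks⇒two-sizes a i b j b<a = cong length (begin
  dedup (replicate (suc i) a ++ replicate (suc j) b)        ≡⟨ dedup-block i a _ (replicate⁺ (suc j) b<a) ⟩
  a ∷ dedup (replicate (suc j) b)                           ≡⟨ cong (λ l → a ∷ dedup l) (sym (++-identityʳ (replicate (suc j) b))) ⟩
  a ∷ dedup (replicate (suc j) b ++ [])                     ≡⟨ cong (a ∷_) (dedup-block j b [] []) ⟩
  a ∷ b ∷ []                                                ∎)
  where open ≡-Reasoning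

twoSized : ℕ → List (List ℕ)
twoSized m = filter (λ p → distinctParts p ≟ 2) (partitions m)

record Blocks (m : ℕ) (p : List ℕ) : Set where
  constructor blocks
  field
    a i b j : ℕ
    shape   : p ≡ replicate i a ++ replicate j b
    b<a     : b < a
    1≤b     : 1 ≤ b
    1≤i     : 1 ≤ i
    1≤j     : 1 ≤ j
    total   : i * a + j * b ≡ m

sum-replicate : ∀ i a → sum (replicate i a) ≡ i * a
sum-replicate zero a = refl
sum-replicate (suc i) a = cong (a +_) (sum-replicate i a)

sum-blocks : ∀ i a j b → sum (replicate i a ++ replicate j b) ≡ i * a + j * b
sum-blocks i a j b = trans (sum-++ (replicate i a) (replicate j b)) (cong₂ _+_ (sum-replicate i a) (sum-replicate j b))

descending-block : ∀ {a k rest} i → 1 ≤ a → a ≤ k → Descending a rest → Descending k (replicate i a ++ rest)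
descending-block zero _ a≤k d = descending-weaken a≤k d
descending-block (suc i) 1≤a a≤k d = cons 1≤a a≤k (descending-block i 1≤a ≤-refl d)

∈twoSized⇒Blocks : ∀ {m p} → p ∈ twoSized m → Blocks m p
∈twoSized⇒Blocks {m} {p} w with ∈-filter⁻ (λ p → distinctParts p ≟ 2) {xs = partitions m} w
... | p∈ , two with ∈-partitions⁻ p∈
...   | d , s with two-sizes⇒blocks p d two
...     | a , i , b , j , eq , b<a , 1≤b =
  blocks a (suc i) b (suc j) eq b<a 1≤b (s≤s z≤n) (s≤s z≤n) (trans (sym (sum-blocks (suc i) a (suc j) b)) (trans (cong sum (sym eq)) s))

Blocks⇒∈twoSized : ∀ {m p} → Blocks m p → p ∈ twoSized m
Blocks⇒∈twoSized {m} (blocks a (suc i) b (suc j) refl b<a 1≤b _ _ total) =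
  ∈-filter⁺ (λ p → distinctParts p ≟ 2) (∈-partitions⁺ descending (trans (sum-blocks (suc i) a (suc j) b) total))
            (blocks⇒two-sizes a i b j b<a)
  where
  a≤m : a ≤ m
  a≤m = subst (a ≤_) total (≤-trans (m≤m+n a (i * a)) (m≤m+n (suc i * a) (suc j * b)))
  descending : Descending m (replicate (suc i) a ++ replicate (suc j) b)
  descending = descending-block (suc i) (≤-trans 1≤b (<⇒≤ b<a)) a≤m
                 (subst (Descending a) (++-identityʳ (replicate (suc j) b)) (descending-block (suc j) 1≤b (<⇒≤ b<a) []))

twoSized-unique : ∀ m → Unique (twoSized m)
twoSized-unique m = Unique.filter⁺ (λ p → distinctParts p ≟ 2) (partsUpTo-unique (suc m) m m)

firstPart : List ℕ → ℕ
firstPart [] = 0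
firstPart (x ∷ _) = x

runLength : ℕ → List ℕ → ℕ
runLength a [] = 0
runLength a (x ∷ xs) with x ≟ a
... | yes _ = suc (runLength a xs)
... | no _  = 0

afterRun : ℕ → List ℕ → List ℕ
afterRun a [] = []
afterRun a (x ∷ xs) with x ≟ a
... | yes _ = afterRun a xs
... | no _  = x ∷ xs

Shape : Set
Shape = ℕ × ℕ × ℕ × ℕ

shapeOf : List ℕ → Shape
shapeOf p = a , runLength a p , firstPart rest , length rest
  where
  a : ℕ
  a = firstPart p
  rest : List ℕ
  rest = afterRun a p

runLength-run : ∀ i a ys → runLength a (replicate i a ++ ys) ≡ i + runLength a ys
runLength-run zero a ys = refl
runLength-run (suc i) a ys with a ≟ a
... | yes _ = cong suc (runLength-run i a ys)
... | no a≢a = ⊥-elim (a≢a refl)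

runLength-other : ∀ j a b → b ≢ a → runLength a (replicate j b) ≡ 0
runLength-other zero a b _ = refl
runLength-other (suc j) a b b≢a with b ≟ a
... | yes b≡a = ⊥-elim (b≢a b≡a)
... | no _ = refl

afterRun-run : ∀ i a ys → afterRun a (replicate i a ++ ys) ≡ afterRun a ys
afterRun-run zero a ys = refl
afterRun-run (suc i) a ys with a ≟ a
... | yes _ = afterRun-run i a ys
... | no a≢a = ⊥-elim (a≢a refl)

afterRun-other : ∀ j a b → b ≢ a → afterRun a (replicate j b) ≡ replicate j b
afterRun-other zero a b _ = refl
afterRun-other (suc j) a b b≢a with b ≟ a
... | yes b≡a = ⊥-elim (b≢a b≡a)
... | no _ = refl

shapeOf-blocks : ∀ a i b j → 1 ≤ i → b ≢ a → 1 ≤ j → shapeOf (replicate i a ++ replicate j b) ≡ (a , i , b , j)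
shapeOf-blocks a (suc i) b (suc j) _ b≢a _ =
  trans (cong₂ (λ i′ rest → a , i′ , firstPart rest , length rest) count after)
        (cong (λ l → a , suc i , b , l) (length-replicate (suc j)))
  where
  count : runLength a (replicate (suc i) a ++ replicate (suc j) b) ≡ suc i
  count = trans (runLength-run (suc i) a _) (trans (cong (suc i +_) (runLength-other (suc j) a b b≢a)) (+-identityʳ _))
  after : afterRun a (replicate (suc i) a ++ replicate (suc j) b) ≡ replicate (suc j) b
  after = trans (afterRun-run (suc i) a _) (afterRun-other (suc j) a b b≢a)

conjugateShape : Shape → List ℕ
conjugateShape (a , i , b , j) = replicate b (i + j) ++ replicate (a ∸ b) i

conjugate : List ℕ → List ℕ
conjugate p = conjugateShape (shapeOf p)

i<i+j : ∀ i j → 1 ≤ j → i < i + j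
i<i+j i j 1≤j = subst (_≤ i + j) (+-comm i 1) (+-monoʳ-≤ i 1≤j)

Blocks-shape : ∀ {m p} (B : Blocks m p) → let open Blocks B in shapeOf p ≡ (a , i , b , j)
Blocks-shape (blocks a i b j refl b<a _ 1≤i 1≤j _) = shapeOf-blocks a i b j 1≤i (<⇒≢ b<a) 1≤j

conjugate-Blocks : ∀ {m p} → Blocks m p → Blocks m (conjugate p)
conjugate-Blocks {m} B@(blocks a i b j _ b<a 1≤b 1≤i 1≤j total) =
  blocks (i + j) b i (a ∸ b) (cong conjugateShape (Blocks-shape B)) (i<i+j i j 1≤j) 1≤i 1≤b (m<n⇒0<n∸m b<a) total′
  where
  regroup : ∀ b i j c → b * (i + j) + c * i ≡ i * (c + b) + j * b
  regroup = solve-∀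
  total′ : b * (i + j) + (a ∸ b) * i ≡ m
  total′ = trans (regroup b i j (a ∸ b)) (trans (cong (λ a′ → i * a′ + j * b) (m∸n+n≡m (<⇒≤ b<a))) total)

conjugate-involutive : ∀ {m p} → Blocks m p → conjugate (conjugate p) ≡ p
conjugate-involutive B@(blocks a i b j refl b<a _ _ _ _) = begin
  conjugate (conjugate p)                               ≡⟨ cong conjugateShape (Blocks-shape (conjugate-Blocks B)) ⟩
  replicate i (b + (a ∸ b)) ++ replicate (i + j ∸ i) b  ≡⟨ cong₂ (λ a′ j′ → replicate i a′ ++ replicate j′ b) (m+[n∸m]≡n (<⇒≤ b<a)) (m+n∸m≡n i j) ⟩
  p                                                     ∎
  where
  open ≡-Reasoning
  p : List ℕ
  p = replicate i a ++ replicate j b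

conjugate-fixed : ∀ {m p} (B : Blocks m p) → conjugate p ≡ p → let open Blocks B in b ≡ i × a ≡ i + j
conjugate-fixed B@(blocks a i b j _ _ _ _ _ _) fixed =
  cong (proj₁ ∘ proj₂) shapes , sym (cong proj₁ shapes)
  where
  shapes : (i + j , b , i , a ∸ b) ≡ (a , i , b , j)
  shapes = trans (sym (Blocks-shape (conjugate-Blocks B))) (trans (cong shapeOf fixed) (Blocks-shape B))

selfConjugate : ℕ → ℕ → List ℕ
selfConjugate x z = replicate x (x + z) ++ replicate z x

record SelfConjugate (m : ℕ) (p : List ℕ) : Set where
  constructor selfConj
  field
    x z   : ℕ
    1≤x   : 1 ≤ x
    1≤z   : 1 ≤ z
    shape : p ≡ selfConjugate x z
    total : x * (x + z) + z * x ≡ m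

FactorPair : ℕ → ℕ × ℕ → Set
FactorPair m (u , v) = (u * v ≡ m) × u < v × u % 2 ≡ v % 2

SelfConjugate⇒Blocks : ∀ {m p} → SelfConjugate m p → Blocks m p
SelfConjugate⇒Blocks (selfConj x z 1≤x 1≤z shape total) = blocks (x + z) x x z shape (i<i+j x z 1≤z) 1≤x 1≤x 1≤z total

toPair : List ℕ → ℕ × ℕ
toPair p = let _ , i , _ , j = shapeOf p in i , i + 2 * j

fromPair : ℕ × ℕ → List ℕ
fromPair (u , v) = selfConjugate u ((v ∸ u) / 2)

toPair-selfConjugate : ∀ {m p} (S : SelfConjugate m p) → let open SelfConjugate S in toPair p ≡ (x , x + 2 * z)
toPair-selfConjugate S = cong (λ (_ , i , _ , j) → i , i + 2 * j) (Blocks-shape (SelfConjugate⇒Blocks S))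

half-gap : ∀ u h → (u + 2 * h ∸ u) / 2 ≡ h
half-gap u h = trans (cong (_/ 2) (trans (m+n∸m≡n u (2 * h)) (*-comm 2 h))) (m*n/n≡m h 2)

fromPair-toPair : ∀ {m p} → SelfConjugate m p → fromPair (toPair p) ≡ p
fromPair-toPair S@(selfConj x z _ _ shape _) =
  trans (cong fromPair (toPair-selfConjugate S)) (trans (cong (selfConjugate x) (half-gap x z)) (sym shape))

suc-parity : ∀ x → suc x % 2 ≢ x % 2
suc-parity zero ()
suc-parity (suc zero) ()
suc-parity (suc (suc x)) eq = suc-parity x (trans (sym (plus-two (suc x))) (trans eq (plus-two x)))
  where
  plus-two : ∀ y → suc (suc y) % 2 ≡ y % 2
  plus-two y = trans (cong (_% 2) (+-comm 2 y)) ([m+n]%n≡m%n y 2)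

even-gap : ∀ x d → (x + d) % 2 ≡ x % 2 → ∃[ h ] d ≡ 2 * h
even-gap x zero _ = 0 , refl
even-gap x (suc zero) same = ⊥-elim (suc-parity x (trans (cong (_% 2) (+-comm 1 x)) same))
even-gap x (suc (suc d)) same with even-gap x d (trans (sym ([m+n]%n≡m%n (x + d) 2)) (trans (cong (_% 2) (regroup x d)) same))
  where
  regroup : ∀ x d → x + d + 2 ≡ x + suc (suc d)
  regroup = solve-∀
... | h , d≡2h = suc h , trans (cong (suc ∘ suc) d≡2h) (sym (*-distribˡ-+ 2 1 h))

pair-gap : ∀ {u v} → u < v → u % 2 ≡ v % 2 → ∃[ h ] 1 ≤ h × v ≡ u + 2 * h
pair-gap {u} {v} u<v same with even-gap u (v ∸ u) (trans (cong (_% 2) (m+[n∸m]≡n (<⇒≤ u<v))) (sym same))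
... | zero , d≡0 = ⊥-elim (<-irrefl (trans (sym (+-identityʳ u)) (trans (cong (u +_) (sym d≡0)) (m+[n∸m]≡n (<⇒≤ u<v)))) u<v)
... | suc h , d≡2h = suc h , s≤s z≤n , trans (sym (m+[n∸m]≡n (<⇒≤ u<v))) (cong (u +_) d≡2h)

factor-positive : ∀ u v → 1 ≤ u * v → 1 ≤ u
factor-positive (suc u) v _ = s≤s z≤n

toPair-factorPair : ∀ {m p} → SelfConjugate m p → FactorPair m (toPair p)
toPair-factorPair {m} S@(selfConj x z _ 1≤z _ total) = subst (FactorPair m) (sym (toPair-selfConjugate S))
  (trans (regroup x z) total , i<i+j x (2 * z) (≤-trans 1≤z (m≤m+n z (z + 0))) ,
   sym (trans (cong (λ t → (x + t) % 2) (*-comm 2 z)) ([m+kn]%n≡m%n x z 2)))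
  where
  regroup : ∀ x z → x * (x + 2 * z) ≡ x * (x + z) + z * x
  regroup = solve-∀

fromPair-selfConjugate : ∀ {m uv} → 1 ≤ m → FactorPair m uv → SelfConjugate m (fromPair uv) × toPair (fromPair uv) ≡ uv
fromPair-selfConjugate {m} {u , _} 1≤m (uv≡m , u<v , same) with pair-gap u<v same
... | h , 1≤h , refl = S , toPair-selfConjugate S
  where
  regroup : ∀ x z → x * (x + z) + z * x ≡ x * (x + 2 * z)
  regroup = solve-∀
  S : SelfConjugate m (fromPair (u , u + 2 * h))
  S = selfConj u h (factor-positive u _ (subst (1 ≤_) (sym uv≡m) 1≤m)) 1≤h
        (cong (selfConjugate u) (half-gap u h)) (trans (regroup u h) uv≡m)

record PairInvolution (m : ℕ) : Set where
  field
    τ                : ℕ × ℕ → ℕ × ℕ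
    preserves        : ∀ {uv} → FactorPair m uv → FactorPair m (τ uv)
    involutive       : ∀ {uv} → FactorPair m uv → τ (τ uv) ≡ uv
    fixed-point-free : ∀ {uv} → FactorPair m uv → τ uv ≢ uv

module Conjugation = InvolutionParity (≡-dec _≟_) conjugate

selfConjugates : ℕ → List (List ℕ)
selfConjugates m = filter Conjugation.fixed? (twoSized m)

ν₂-parity : ∀ m → ν₂ m % 2 ≡ length (selfConjugates m) % 2
ν₂-parity m = Conjugation.involution-parity (twoSized m) (twoSized-unique m) record
  { closed     = λ w → Blocks⇒∈twoSized (conjugate-Blocks (∈twoSized⇒Blocks {m} w))
  ; involutive = λ w → conjugate-involutive (∈twoSized⇒Blocks {m} w)
  }

∈selfConjugates⇒ : ∀ {m p} → p ∈ selfConjugates m → SelfConjugate m p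
∈selfConjugates⇒ {m} w with ∈-filter⁻ Conjugation.fixed? {xs = twoSized m} w
... | w′ , fixed with ∈twoSized⇒Blocks w′
...   | B@(blocks _ i _ j shape _ _ 1≤i 1≤j total) with conjugate-fixed B fixed
...     | refl , refl = selfConj i j 1≤i 1≤j shape total

SelfConjugate⇒∈ : ∀ {m p} → SelfConjugate m p → p ∈ selfConjugates m
SelfConjugate⇒∈ {m} S@(selfConj x z _ _ refl _) = ∈-filter⁺ Conjugation.fixed? (Blocks⇒∈twoSized B) self-conjugate
  where
  B : Blocks m (selfConjugate x z)
  B = SelfConjugate⇒Blocks S
  self-conjugate : conjugate (selfConjugate x z) ≡ selfConjugate x z
  self-conjugate = trans (cong conjugateShape (Blocks-shape B))
                         (cong (λ k → replicate x (x + z) ++ replicate k x) (m+n∸m≡n x z))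

module Transport {m} (1≤m : 1 ≤ m) (T : PairInvolution m) where
  open PairInvolution T

  σ : List ℕ → List ℕ
  σ p = fromPair (τ (toPair p))

  module Transported = InvolutionParity (≡-dec _≟_) σ

  σ-involution : Transported.InvolutionOn (selfConjugates m)
  σ-involution = record
    { closed     = λ w → SelfConjugate⇒∈ (proj₁ (image w))
    ; involutive = λ {p} w → begin
        fromPair (τ (toPair (σ p)))  ≡⟨ cong (fromPair ∘ τ) (proj₂ (image w)) ⟩
        fromPair (τ (τ (toPair p)))  ≡⟨ cong fromPair (involutive (pair w)) ⟩
        fromPair (toPair p)          ≡⟨ fromPair-toPair (∈selfConjugates⇒ {m} w) ⟩
        p                            ∎
    }
    where
    open ≡-Reasoning
    pair : ∀ {p} → p ∈ selfConjugates m → FactorPair m (toPair p)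
    pair w = toPair-factorPair (∈selfConjugates⇒ {m} w)
    image : ∀ {p} → p ∈ selfConjugates m → SelfConjugate m (σ p) × toPair (σ p) ≡ τ (toPair p)
    image w = fromPair-selfConjugate 1≤m (preserves (pair w))

  σ-no-fixed : ∀ {p} → p ∈ selfConjugates m → σ p ≢ p
  σ-no-fixed {p} w σp≡p = fixed-point-free pair (trans (sym (proj₂ (fromPair-selfConjugate 1≤m (preserves pair)))) (cong toPair σp≡p))
    where
    pair : FactorPair m (toPair p)
    pair = toPair-factorPair (∈selfConjugates⇒ {m} w)

  selfConjugates-even : length (selfConjugates m) % 2 ≡ 0
  selfConjugates-even =
    trans (Transported.involution-parity (selfConjugates m) (Unique.filter⁺ Conjugation.fixed? (twoSized-unique m)) σ-involution)
          (cong (λ l → length l % 2) (filter-none Transported.fixed? (All.tabulate σ-no-fixed)))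

PowerSplit : ℕ → ℕ → ℕ × ℕ → Set
PowerSplit r n (k , w) = (n ≡ r ^ k * w) × ¬ (r ∣ w) × 1 ≤ w

-- Splitting off the largest power of r by repeated division; fuel f ≥ n suffices.
factorOutWith : (r : ℕ) .{{_ : NonZero r}} → ℕ → ℕ → ℕ × ℕ
factorOutWith r zero n = 0 , n
factorOutWith r (suc f) n with n % r ≟ 0
... | yes _ = map₁ suc (factorOutWith r f (n / r))
... | no _  = 0 , n

factorOut : (r : ℕ) .{{_ : NonZero r}} → ℕ → ℕ × ℕ
factorOut r n = factorOutWith r n n

factorOutWith-split : ∀ r .{{_ : NonZero r}} → 1 < r → ∀ f n → 1 ≤ n → n ≤ f → PowerSplit r n (factorOutWith r f n)
factorOutWith-split r 1<r zero n 1≤n n≤0 = ⊥-elim (<⇒≱ 1≤n n≤0)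
factorOutWith-split r 1<r (suc f) n 1≤n n≤f with n % r ≟ 0
... | no n%r≢0 = sym (*-identityˡ n) , (λ r∣n → n%r≢0 (n∣m⇒m%n≡0 n r r∣n)) , 1≤n
... | yes n%r≡0 = n≡r^k*w , r∤w , 1≤w
  where
  q : ℕ
  q = n / r
  n≡q*r : n ≡ q * r
  n≡q*r = sym (m/n*n≡m (m%n≡0⇒n∣m n r n%r≡0))
  1≤q : 1 ≤ q
  1≤q = m≥n⇒m/n>0 (∣⇒≤ {{>-nonZero 1≤n}} (m%n≡0⇒n∣m n r n%r≡0))
  q<n : q < n
  q<n = m/n<m n r {{>-nonZero 1≤n}} 1<r
  k w : ℕ
  k = proj₁ (factorOutWith r f q)
  w = proj₂ (factorOutWith r f q)
  rec : PowerSplit r q (k , w)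
  rec = factorOutWith-split r 1<r f q 1≤q (≤-pred (≤-trans q<n n≤f))
  r∤w : ¬ (r ∣ w)
  r∤w = proj₁ (proj₂ rec)
  1≤w : 1 ≤ w
  1≤w = proj₂ (proj₂ rec)
  regroup : ∀ a w r → a * w * r ≡ r * a * w
  regroup = solve-∀
  n≡r^k*w : n ≡ r ^ suc k * w
  n≡r^k*w = trans n≡q*r (trans (cong (_* r) (proj₁ rec)) (regroup (r ^ k) w r))

factorOut-split : ∀ r .{{_ : NonZero r}} → 1 < r → ∀ n → 1 ≤ n → PowerSplit r n (factorOut r n)
factorOut-split r 1<r n 1≤n = factorOutWith-split r 1<r n n 1≤n ≤-refl

power-∣ : ∀ r {a b} → a ≤ b → r ^ a ∣ r ^ b
power-∣ r {a} {b} a≤b = divides (r ^ (b ∸ a)) (trans (cong (r ^_) (sym (m∸n+n≡m a≤b))) (^-distribˡ-+-* r (b ∸ a) a))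

exact-unique : ∀ {r e e′ m} → ExactExponent r e m → ExactExponent r e′ m → e ≡ e′
exact-unique {r} {e} {e′} (r^e∣m , r^e+1∤m) (r^e′∣m , r^e′+1∤m) with <-cmp e e′
... | tri< e<e′ _ _ = ⊥-elim (r^e+1∤m (∣-trans (power-∣ r e<e′) r^e′∣m))
... | tri≈ _ e≡e′ _ = e≡e′
... | tri> _ _ e′<e = ⊥-elim (r^e′+1∤m (∣-trans (power-∣ r e′<e) r^e∣m))

split-exact : ∀ r .{{_ : NonZero r}} k w → ¬ (r ∣ w) → ExactExponent r k (r ^ k * w)
split-exact r k w r∤w = m∣m*n w , λ r^k+1∣ → r∤w (*-cancelˡ-∣ (r ^ k) {{m^n≢0 r k}} (subst (_∣ r ^ k * w) (*-comm r (r ^ k)) r^k+1∣))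

factorOut-exact : ∀ r .{{_ : NonZero r}} → 1 < r → ∀ k w → ¬ (r ∣ w) → 1 ≤ w → factorOut r (r ^ k * w) ≡ (k , w)
factorOut-exact r 1<r k w r∤w 1≤w = cong₂ _,_ k′≡k w′≡w
  where
  n k′ w′ : ℕ
  n = r ^ k * w
  k′ = proj₁ (factorOut r n)
  w′ = proj₂ (factorOut r n)
  split : PowerSplit r n (k′ , w′)
  split = factorOut-split r 1<r n (*-mono-≤ (m^n>0 r k) 1≤w)
  k′≡k : k′ ≡ k
  k′≡k = exact-unique (subst (ExactExponent r k′) (sym (proj₁ split)) (split-exact r k′ w′ (proj₁ (proj₂ split)))) (split-exact r k w r∤w)
  w′≡w : w′ ≡ w
  w′≡w = *-cancelˡ-≡ w′ w (r ^ k) {{m^n≢0 r k}} (trans (cong (λ k → r ^ k * w′) (sym k′≡k)) (sym (proj₁ split)))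

prime>1 : ∀ {p} → Prime p → 1 < p
prime>1 {p} p-prime = nonTrivial⇒n>1 p {{prime⇒nonTrivial p-prime}}

prime∣prime : ∀ {r s} → Prime r → Prime s → s ∣ r → s ≡ r
prime∣prime r-prime s-prime s∣r with prime⇒irreducible r-prime s∣r
... | inj₂ s≡r = s≡r
... | inj₁ s≡1 = ⊥-elim (nonTrivial⇒≢1 {{prime⇒nonTrivial s-prime}} s≡1)

prime∣power : ∀ {s} r e → Prime s → s ∣ r ^ e → s ∣ r
prime∣power r zero s-prime s∣1 = ⊥-elim (nonTrivial⇒≢1 {{prime⇒nonTrivial s-prime}} (∣1⇒≡1 s∣1))
prime∣power r (suc e) s-prime s∣r^e+1 with euclidsLemma r (r ^ e) s-prime s∣r^e+1
... | inj₁ s∣r = s∣r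
... | inj₂ s∣r^e = prime∣power r e s-prime s∣r^e

prime∤* : ∀ {s a b} → Prime s → ¬ (s ∣ a) → ¬ (s ∣ b) → ¬ (s ∣ a * b)
prime∤* {s} {a} {b} s-prime s∤a s∤b s∣ab with euclidsLemma a b s-prime s∣ab
... | inj₁ s∣a = s∤a s∣a
... | inj₂ s∣b = s∤b s∣b

double-even : ∀ n → (n + n) % 2 ≡ 0
double-even n = trans (cong (λ k → (n + k) % 2) (sym (+-identityʳ n))) (trans (cong (_% 2) (*-comm 2 n)) (m*n%n≡0 n 2))

odd-exponent⇒not-square : ∀ {s f m} → Prime s → ExactExponent s f m → f % 2 ≡ 1 →
                          ∀ c t → ¬ (s ∣ c) → 1 ≤ t → m ≢ c * (t * t)
odd-exponent⇒not-square {s} {f} {m} s-prime s-exact f-odd c t s∤c 1≤t m≡ct² = 0≢1+n (trans (sym (double-even γ)) odd)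
  where
  instance
    s-nonZero : NonZero s
    s-nonZero = prime⇒nonZero s-prime
  γ w : ℕ
  γ = proj₁ (factorOut s t)
  w = proj₂ (factorOut s t)
  split : PowerSplit s t (γ , w)
  split = factorOut-split s (prime>1 s-prime) t 1≤t
  s∤w : ¬ (s ∣ w)
  s∤w = proj₁ (proj₂ split)
  regroup : ∀ c g w → c * ((g * w) * (g * w)) ≡ (g * g) * (c * (w * w))
  regroup = solve-∀
  m≡ : m ≡ s ^ (γ + γ) * (c * (w * w))
  m≡ = trans m≡ct² (trans (cong (λ t → c * (t * t)) (proj₁ split))
         (trans (regroup c (s ^ γ) w) (cong (_* (c * (w * w))) (sym (^-distribˡ-+-* s γ γ)))))
  2γ≡f : γ + γ ≡ f
  2γ≡f = exact-unique (subst (ExactExponent s (γ + γ)) (sym m≡) (split-exact s (γ + γ) _ (prime∤* s-prime s∤c (prime∤* s-prime s∤w s∤w)))) s-exact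
  odd : (γ + γ) % 2 ≡ 1
  odd = trans (cong (_% 2) 2γ≡f) f-odd

odd-power : ∀ {r} → r % 2 ≡ 1 → ∀ k → r ^ k % 2 ≡ 1
odd-power r-odd zero = refl
odd-power {r} r-odd (suc k) = trans (%-distribˡ-* r (r ^ k) 2) (cong₂ (λ a b → (a * b) % 2) r-odd (odd-power r-odd k))

odd-power-parity : ∀ {r} → r % 2 ≡ 1 → ∀ k w → (r ^ k * w) % 2 ≡ w % 2
odd-power-parity {r} r-odd k w = begin
  (r ^ k * w) % 2                    ≡⟨ %-distribˡ-* (r ^ k) w 2 ⟩
  ((r ^ k % 2) * (w % 2)) % 2        ≡⟨ cong (λ a → (a * (w % 2)) % 2) (odd-power r-odd k) ⟩
  (1 * (w % 2)) % 2                  ≡⟨ cong (_% 2) (*-identityˡ (w % 2)) ⟩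
  w % 2 % 2                          ≡⟨ m%n%n≡m%n w 2 ⟩
  w % 2                              ∎
  where open ≡-Reasoning

odd-prime : ∀ {r} → Prime r → r ≢ 2 → r % 2 ≡ 1
odd-prime {r} r-prime r≢2 with r % 2 in r%2 | m%n<n r 2
... | zero  | _ = ⊥-elim (r≢2 (sym (prime∣prime r-prime prime[2] (m%n≡0⇒n∣m r 2 r%2))))
... | suc zero | _ = refl
... | suc (suc _) | s≤s (s≤s ())

sortPair : ℕ × ℕ → ℕ × ℕ
sortPair (x , y) with x ≤? y
... | yes _ = x , y
... | no _  = y , x

sortPair-cases : ∀ x y → (x ≤ y × sortPair (x , y) ≡ (x , y)) ⊎ (y < x × sortPair (x , y) ≡ (y , x))
sortPair-cases x y with x ≤? y
... | yes x≤y = inj₁ (x≤y , refl)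
... | no x≰y = inj₂ (≰⇒> x≰y , refl)

sortPair-ordered : ∀ {x y} → x < y → sortPair (x , y) ≡ (x , y)
sortPair-ordered {x} {y} x<y with x ≤? y
... | yes _ = refl
... | no x≰y = ⊥-elim (x≰y (<⇒≤ x<y))

sortPair-reversed : ∀ {x y} → x < y → sortPair (y , x) ≡ (x , y)
sortPair-reversed {x} {y} x<y with y ≤? x
... | yes y≤x = ⊥-elim (<⇒≱ x<y y≤x)
... | no _ = refl

-- Exchanging the r-parts of u and v, then reordering, is an involution on the factor pairs of m:
-- a fixed point would force either v_r(u) = v_r(v), so e even, or m = rᵉ · w², so s to an even exponent.
module ValuationSwap {r s e f m : ℕ} (r-prime : Prime r) (s-prime : Prime s) (s≢r : s ≢ r) (r-odd : r % 2 ≡ 1)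
  (r-exact : ExactExponent r e m) (e-odd : e % 2 ≡ 1) (s-exact : ExactExponent s f m) (f-odd : f % 2 ≡ 1) (1≤m : 1 ≤ m) where

  instance
    r-nonZero : NonZero r
    r-nonZero = prime⇒nonZero r-prime

  swapParts : ℕ × ℕ → ℕ × ℕ
  swapParts (u , v) = let α , u′ = factorOut r u ; β , v′ = factorOut r v in r ^ β * u′ , r ^ α * v′

  τ : ℕ × ℕ → ℕ × ℕ
  τ = sortPair ∘ swapParts

  module Swapped {u v} (pair : FactorPair m (u , v)) where
    α u′ β v′ t₁ t₂ : ℕ
    α = proj₁ (factorOut r u)
    u′ = proj₂ (factorOut r u)
    β = proj₁ (factorOut r v)
    v′ = proj₂ (factorOut r v)
    t₁ = r ^ β * u′
    t₂ = r ^ α * v′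

    1≤u : 1 ≤ u
    1≤u = factor-positive u v (subst (1 ≤_) (sym (proj₁ pair)) 1≤m)
    1≤v : 1 ≤ v
    1≤v = factor-positive v u (subst (1 ≤_) (trans (sym (proj₁ pair)) (*-comm u v)) 1≤m)
    u-split : PowerSplit r u (α , u′)
    u-split = factorOut-split r (prime>1 r-prime) u 1≤u
    v-split : PowerSplit r v (β , v′)
    v-split = factorOut-split r (prime>1 r-prime) v 1≤v

    exchange : ∀ a b x y → (a * x) * (b * y) ≡ (b * x) * (a * y)
    exchange = solve-∀
    collect : ∀ a b x y → (a * x) * (b * y) ≡ (a * b) * (x * y)
    collect = solve-∀

    product : t₁ * t₂ ≡ m
    product = trans (exchange (r ^ β) (r ^ α) u′ v′) (trans (cong₂ _*_ (sym (proj₁ u-split)) (sym (proj₁ v-split))) (proj₁ pair))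

    t₁-split : factorOut r t₁ ≡ (β , u′)
    t₁-split = factorOut-exact r (prime>1 r-prime) β u′ (proj₁ (proj₂ u-split)) (proj₂ (proj₂ u-split))
    t₂-split : factorOut r t₂ ≡ (α , v′)
    t₂-split = factorOut-exact r (prime>1 r-prime) α v′ (proj₁ (proj₂ v-split)) (proj₂ (proj₂ v-split))

    swap-swap : swapParts (t₁ , t₂) ≡ (u , v)
    swap-swap = trans (cong₂ (λ (β′ , u″) (α′ , v″) → r ^ α′ * u″ , r ^ β′ * v″) t₁-split t₂-split)
                      (sym (cong₂ _,_ (proj₁ u-split) (proj₁ v-split)))

    swap-swap-reversed : swapParts (t₂ , t₁) ≡ (v , u)
    swap-swap-reversed = trans (cong₂ (λ (α′ , v″) (β′ , u″) → r ^ β′ * v″ , r ^ α′ * u″) t₂-split t₁-split)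
                               (sym (cong₂ _,_ (proj₁ v-split) (proj₁ u-split)))

    exponents : α + β ≡ e
    exponents = exact-unique (subst (ExactExponent r (α + β)) (sym m≡) (split-exact r (α + β) (u′ * v′)
                  (prime∤* r-prime (proj₁ (proj₂ u-split)) (proj₁ (proj₂ v-split))))) r-exact
      where
      m≡ : m ≡ r ^ (α + β) * (u′ * v′)
      m≡ = trans (sym (proj₁ pair)) (trans (cong₂ _*_ (proj₁ u-split) (proj₁ v-split))
             (trans (collect (r ^ α) (r ^ β) u′ v′) (cong (_* (u′ * v′)) (sym (^-distribˡ-+-* r α β)))))

    -- m is not a square, so the two new factors differ
    t₁≢t₂ : t₁ ≢ t₂
    t₁≢t₂ t₁≡t₂ = odd-exponent⇒not-square {f = f} s-prime s-exact f-odd 1 t₁ (λ s∣1 → <⇒≢ (prime>1 s-prime) (sym (∣1⇒≡1 s∣1)))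
      (*-mono-≤ (m^n>0 r β) (proj₂ (proj₂ u-split)))
      (trans (sym product) (trans (cong (t₁ *_) (sym t₁≡t₂)) (sym (*-identityˡ (t₁ * t₁)))))

    -- r is odd, so changing r-parts does not change parities
    parity : t₁ % 2 ≡ t₂ % 2
    parity = begin
      t₁ % 2                ≡⟨ odd-power-parity r-odd β u′ ⟩
      u′ % 2                ≡⟨ sym (odd-power-parity r-odd α u′) ⟩
      (r ^ α * u′) % 2      ≡⟨ cong (_% 2) (sym (proj₁ u-split)) ⟩
      u % 2                 ≡⟨ proj₂ (proj₂ pair) ⟩
      v % 2                 ≡⟨ cong (_% 2) (proj₁ v-split) ⟩
      (r ^ β * v′) % 2      ≡⟨ odd-power-parity r-odd β v′ ⟩
      v′ % 2                ≡⟨ sym (odd-power-parity r-odd α v′) ⟩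
      t₂ % 2                ∎
      where open ≡-Reasoning

    τ-factorPair : FactorPair m (τ (u , v))
    τ-factorPair with sortPair-cases t₁ t₂
    ... | inj₁ (t₁≤t₂ , sorted) rewrite sorted = product , ≤∧≢⇒< t₁≤t₂ t₁≢t₂ , parity
    ... | inj₂ (t₂<t₁ , sorted) rewrite sorted = trans (*-comm t₂ t₁) product , t₂<t₁ , sym parity

    τ-involutive : τ (τ (u , v)) ≡ (u , v)
    τ-involutive with sortPair-cases t₁ t₂
    ... | inj₁ (_ , sorted) rewrite sorted = trans (cong sortPair swap-swap) (sortPair-ordered (proj₁ (proj₂ pair)))
    ... | inj₂ (_ , sorted) rewrite sorted = trans (cong sortPair swap-swap-reversed) (sortPair-reversed (proj₁ (proj₂ pair)))

    τ-no-fixed : τ (u , v) ≢ (u , v)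
    τ-no-fixed fixed with sortPair-cases t₁ t₂
    ... | inj₁ (_ , sorted) = 0≢1+n (trans (sym (double-even α)) (trans (cong (λ b → (α + b) % 2) (sym β≡α)) (trans (cong (_% 2) exponents) e-odd)))
      where
      -- t₁ = u forces β = α, so e = α + α would be even
      β≡α : β ≡ α
      β≡α = cong proj₁ (trans (sym t₁-split) (cong (factorOut r) (cong proj₁ (trans (sym sorted) fixed))))
    ... | inj₂ (_ , sorted) = odd-exponent⇒not-square {f = f} s-prime s-exact f-odd (r ^ e) u′ s∤r^e (proj₂ (proj₂ u-split)) m≡
      where
      -- t₂ = u forces v′ = u′, so m = rᵉ · u′² would give s an even exponent
      v′≡u′ : v′ ≡ u′
      v′≡u′ = cong proj₂ (trans (sym t₂-split) (cong (factorOut r) (cong proj₁ (trans (sym sorted) fixed))))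
      s∤r^e : ¬ (s ∣ r ^ e)
      s∤r^e s∣r^e = s≢r (prime∣prime r-prime s-prime (prime∣power r e s-prime s∣r^e))
      m≡ : m ≡ r ^ e * (u′ * u′)
      m≡ = trans (sym (proj₁ pair)) (trans (cong₂ _*_ (proj₁ u-split) (trans (proj₁ v-split) (cong (r ^ β *_) v′≡u′)))
             (trans (collect (r ^ α) (r ^ β) u′ u′) (cong (λ k → k * (u′ * u′)) (trans (sym (^-distribˡ-+-* r α β)) (cong (r ^_) exponents)))))

  valuationSwap : PairInvolution m
  valuationSwap = record
    { τ = τ
    ; preserves = λ { {_ , _} pair → Swapped.τ-factorPair pair }
    ; involutive = λ { {_ , _} pair → Swapped.τ-involutive pair }
    ; fixed-point-free = λ { {_ , _} pair → Swapped.τ-no-fixed pair }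
    }

ν₂-even : ∀ {r s e f m} → 0 < m → Prime r → Prime s → s ≢ r → r % 2 ≡ 1 →
          ExactExponent r e m → e % 2 ≡ 1 → ExactExponent s f m → f % 2 ≡ 1 → ν₂ m % 2 ≡ 0
ν₂-even {e = e} {f} {m} 0<m r-prime s-prime s≢r r-odd r-exact e-odd s-exact f-odd =
  trans (ν₂-parity m) (Transport.selfConjugates-even 0<m
    (ValuationSwap.valuationSwap {e = e} {f} r-prime s-prime s≢r r-odd r-exact e-odd s-exact f-odd 0<m))

mainTheorem5 : (m : ℕ) → 0 < m →
    (p q e f : ℕ) → Prime p → Prime q → p ≢ q →
    ExactExponent p e m → e % 2 ≡ 1 →
    ExactExponent q f m → f % 2 ≡ 1 →
    ν₂ m % 2 ≡ 0
mainTheorem5 m 0<m p q e f p-prime q-prime p≢q p-exact e-odd q-exact f-odd with p ≟ 2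
... | no p≢2   = ν₂-even {e = e} {f} 0<m p-prime q-prime (≢-sym p≢q) (odd-prime p-prime p≢2) p-exact e-odd q-exact f-odd
... | yes refl = ν₂-even {e = f} {e} 0<m q-prime p-prime p≢q (odd-prime q-prime (≢-sym p≢q)) q-exact f-odd p-exact e-odd
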